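{- For every $\pi$-calculus context $C$, every invisible $\pi$-calculus process $I$ and every $\pi$-calculus process $P$, it holds that $C[I]\lesssim_\omega C[P]$.
   Context: The $\pi$-calculus is Milner–Parrow–Walker's $\pi$-calculus (without match) with its standard labelled transition semantics; input and output actions are visible, $\tau$ is invisible. A context is a term with one hole; $C[P]$ is hole filling. $\Rightarrow$ is the reflexive-transitive closure of $\xrightarrow{\tau}$; $\stackrel{\hat\mu}{\Rightarrow}$ is $\Rightarrow$ if $\mu=\tau$ and $\Rightarrow\xrightarrow{\mu}\Rightarrow$ otherwise. $P\Downarrow$ iff $P\Rightarrow\xrightarrow{\alpha}\Rightarrow P'$ for some visible $\alpha$; $P$ is invisible iff not $P\Downarrow$. Relations $\lesssim_k$: $\lesssim_0$ is the universal relation on processes; for $1\le k<\omega$, $Q\lesssim_k P$ iff whenever $Q\xrightarrow{\mu}Q'$ there is $P'$ with $P\stackrel{\hat\mu}{\Rightarrow}P'$ and $Q'\lesssim_{k-1}P'$; $Q\lesssim_\omega P$ iff $Q\lesssim_k P$ for all $k<\omega$. -}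

module Defs where

open import Data.Nat using (ℕ; zero; suc)
open import Data.Product using (Σ; ∃; _×_; _,_)
open import Data.Unit using (⊤)
open import Relation.Nullary using (¬_)
open import Relation.Binary.PropositionalEquality using (_≡_)
open import Relation.Binary.Construct.Closure.ReflexiveTransitive using (Star)

-- Syntax of the (monadic, match-free) π-calculus of Milner–Parrow–Walker,
-- with names as de Bruijn indices (ℕ).  A binder (input prefix, ν)
-- binds index 0 in its body; free names of the body are shifted by one.

data Prefix : Set where
  tauₚ : Prefix
  outₚ : ℕ → ℕ → Prefix
  inpₚ : ℕ → Prefix

data Proc : Set where
  𝟎   : Proc
  _·_ : Prefix → Proc → Proc
  _⊕_ : Proc → Proc → Proc
  _∥_ : Proc → Proc → Proc
  ν   : Proc → Proc
  !_  : Proc → Proc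

infixr 9 _·_
infixl 6 _⊕_
infixl 5 _∥_

ext : (ℕ → ℕ) → ℕ → ℕ
ext ρ zero    = zero
ext ρ (suc n) = suc (ρ n)

renamePre : (ℕ → ℕ) → Prefix → Prefix
renamePre ρ tauₚ       = tauₚ
renamePre ρ (outₚ x y) = outₚ (ρ x) (ρ y)
renamePre ρ (inpₚ x)   = inpₚ (ρ x)

bodyRen : Prefix → (ℕ → ℕ) → ℕ → ℕ
bodyRen tauₚ       ρ = ρ
bodyRen (outₚ _ _) ρ = ρ
bodyRen (inpₚ _)   ρ = ext ρ

rename : (ℕ → ℕ) → Proc → Proc
rename ρ 𝟎       = 𝟎
rename ρ (π · P) = renamePre ρ π · rename (bodyRen π ρ) P
rename ρ (P ⊕ Q) = rename ρ P ⊕ rename ρ Q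
rename ρ (P ∥ Q) = rename ρ P ∥ rename ρ Q
rename ρ (ν P)   = ν (rename (ext ρ) P)
rename ρ (! P)   = ! rename ρ P

-- substitution of the name y for the bound name 0 (instantiating a binder)
inst : ℕ → ℕ → ℕ
inst y zero    = y
inst y (suc n) = n

swap : ℕ → ℕ
swap zero          = suc zero
swap (suc zero)    = zero
swap (suc (suc n)) = suc (suc n)

-- Actions (late semantics):  τ, free output x̄y, bound output x̄(·),
-- input x(·).  After a bound output / input the residual has one extra
-- name in scope, at index 0 (the extruded / received name).

data Act : Set where
  τ    : Act
  out  : ℕ → ℕ → Act
  bout : ℕ → Act
  inp  : ℕ → Act

shiftAct : Act → Act
shiftAct τ         = τ
shiftAct (out x y) = out (suc x) (suc y)
shiftAct (bout x)  = bout (suc x)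
shiftAct (inp x)   = inp (suc x)

-- how a process that sits beside the acting one is adjusted
-- (weakened by the extra bound name for bound actions)
side : Act → Proc → Proc
side τ         Q = Q
side (out _ _) Q = Q
side (bout _)  Q = rename suc Q
side (inp _)   Q = rename suc Q

-- how the residual under a restriction is adjusted
-- (the new bound name and the restricted name are exchanged)
resCont : Act → Proc → Proc
resCont τ         P = P
resCont (out _ _) P = P
resCont (bout _)  P = rename swap P
resCont (inp _)   P = rename swap P

infix 4 _─[_]→_
data _─[_]→_ : Proc → Act → Proc → Set where
  preτ   : ∀ {P} → (tauₚ · P) ─[ τ ]→ P
  preOut : ∀ {x y P} → (outₚ x y · P) ─[ out x y ]→ P
  preInp : ∀ {x P} → (inpₚ x · P) ─[ inp x ]→ P
  sumL   : ∀ {P Q α P'} → P ─[ α ]→ P' → P ⊕ Q ─[ α ]→ P'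
  sumR   : ∀ {P Q α Q'} → Q ─[ α ]→ Q' → P ⊕ Q ─[ α ]→ Q'
  parL   : ∀ {P Q α P'} → P ─[ α ]→ P' → P ∥ Q ─[ α ]→ P' ∥ side α Q
  parR   : ∀ {P Q α Q'} → Q ─[ α ]→ Q' → P ∥ Q ─[ α ]→ side α P ∥ Q'
  comL   : ∀ {P Q x y P' Q'} → P ─[ out x y ]→ P' → Q ─[ inp x ]→ Q' →
           P ∥ Q ─[ τ ]→ P' ∥ rename (inst y) Q'
  comR   : ∀ {P Q x y P' Q'} → P ─[ inp x ]→ P' → Q ─[ out x y ]→ Q' →
           P ∥ Q ─[ τ ]→ rename (inst y) P' ∥ Q'
  closeL : ∀ {P Q x P' Q'} → P ─[ bout x ]→ P' → Q ─[ inp x ]→ Q' →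
           P ∥ Q ─[ τ ]→ ν (P' ∥ Q')
  closeR : ∀ {P Q x P' Q'} → P ─[ inp x ]→ P' → Q ─[ bout x ]→ Q' →
           P ∥ Q ─[ τ ]→ ν (P' ∥ Q')
  res    : ∀ {P α P'} → P ─[ shiftAct α ]→ P' → ν P ─[ α ]→ ν (resCont α P')
  open'  : ∀ {P x P'} → P ─[ out (suc x) zero ]→ P' → ν P ─[ bout x ]→ P'
  rep    : ∀ {P α P'} → P ∥ ! P ─[ α ]→ P' → ! P ─[ α ]→ P'

τstep : Proc → Proc → Set
τstep P Q = P ─[ τ ]→ Q

infix 4 _⟹_
_⟹_ : Proc → Proc → Set
_⟹_ = Star τstep

weak : Proc → Act → Proc → Set
weak P α P' = Σ Proc λ P₁ → Σ Proc λ P₂ →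
  (P ⟹ P₁) × (P₁ ─[ α ]→ P₂) × (P₂ ⟹ P')

weakHat : Proc → Act → Proc → Set
weakHat P τ         P' = P ⟹ P'
weakHat P (out x y) P' = weak P (out x y) P'
weakHat P (bout x)  P' = weak P (bout x) P'
weakHat P (inp x)   P' = weak P (inp x) P'

Visible : Act → Set
Visible α = ¬ (α ≡ τ)

_⇓ : Proc → Set
P ⇓ = Σ Act λ α → Visible α × Σ Proc λ P' → weak P α P'

Invisible : Proc → Set
Invisible P = ¬ (P ⇓)

_≲[_]_ : Proc → ℕ → Proc → Set
Q ≲[ zero ]  P = ⊤
Q ≲[ suc k ] P = ∀ μ Q' → Q ─[ μ ]→ Q' →
  Σ Proc λ P' → weakHat P μ P' × (Q' ≲[ k ] P')

_≲ω_ : Proc → Proc → Set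
Q ≲ω P = ∀ k → Q ≲[ k ] P

-- One-hole contexts and (name-capturing) hole filling

data Ctx : Set where
  ∙    : Ctx
  _·ᶜ_ : Prefix → Ctx → Ctx
  _⊕ˡ_ : Ctx → Proc → Ctx
  _⊕ʳ_ : Proc → Ctx → Ctx
  _∥ˡ_ : Ctx → Proc → Ctx
  _∥ʳ_ : Proc → Ctx → Ctx
  νᶜ   : Ctx → Ctx
  !ᶜ   : Ctx → Ctx

_[_] : Ctx → Proc → Proc
∙        [ R ] = R
(π ·ᶜ C) [ R ] = π · (C [ R ])
(C ⊕ˡ Q) [ R ] = (C [ R ]) ⊕ Q
(P ⊕ʳ C) [ R ] = P ⊕ (C [ R ])
(C ∥ˡ Q) [ R ] = (C [ R ]) ∥ Q
(P ∥ʳ C) [ R ] = P ∥ (C [ R ])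
νᶜ C     [ R ] = ν (C [ R ])
!ᶜ C     [ R ] = ! (C [ R ])

-- Call Q ≼ P when Q arises from P by replacing subterms with invisible
-- processes, discarding summands of P and unfolding replications of P;
-- the last two record τ-moves of invisible subterms, which P answers by
-- standing still. Every other move of Q is matched by the same move of
-- P, so ≼ ⊆ ≲ω, and C[I] ≼ C[P] by construction. As communication
-- renames residuals, ≼ must be closed under renaming, i.e. renaming must
-- preserve invisibility: a τ-move of a renamed process is either the
-- image of a τ-move or a communication on two distinct names that the
-- renaming identifies, and then the original process already had a
-- visible move.
module Submission where

open import Defs
open import Data.Nat using (ℕ; zero; suc)
open import Data.Nat.Properties using (suc-injective; _≟_)
open import Data.Product using (Σ; _×_; _,_)
open import Data.Sum using (_⊎_; inj₁; inj₂)
open import Data.Unit using (tt)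
open import Data.Empty using (⊥-elim)
open import Relation.Nullary using (yes; no)
open import Relation.Binary.PropositionalEquality
  using (_≡_; _≢_; refl; sym; trans; cong; cong₂)
open import Relation.Binary.Construct.Closure.ReflexiveTransitive using (ε; _◅_)

ext-compose : ∀ {f g h} → (∀ n → f (g n) ≡ h n) → ∀ n → ext f (ext g n) ≡ ext h n
ext-compose e zero    = refl
ext-compose e (suc n) = cong suc (e n)

rename-compose : ∀ {f g h} → (∀ n → f (g n) ≡ h n) →
                 ∀ P → rename f (rename g P) ≡ rename h P
rename-compose e 𝟎              = refl
rename-compose e (tauₚ · P)     = cong (tauₚ ·_) (rename-compose e P)
rename-compose e (outₚ x y · P) = cong₂ _·_ (cong₂ outₚ (e x) (e y)) (rename-compose e P)
rename-compose e (inpₚ x · P)   = cong₂ _·_ (cong inpₚ (e x)) (rename-compose (ext-compose e) P)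
rename-compose e (P ⊕ Q)        = cong₂ _⊕_ (rename-compose e P) (rename-compose e Q)
rename-compose e (P ∥ Q)        = cong₂ _∥_ (rename-compose e P) (rename-compose e Q)
rename-compose e (ν P)          = cong ν (rename-compose (ext-compose e) P)
rename-compose e (! P)          = cong !_ (rename-compose e P)

rename-commute : ∀ {f g f′ g′} → (∀ n → f (g n) ≡ g′ (f′ n)) →
                 ∀ P → rename f (rename g P) ≡ rename g′ (rename f′ P)
rename-commute e P = trans (rename-compose e P) (sym (rename-compose (λ _ → refl) P))

rename-suc-commute : ∀ ρ P → rename suc (rename ρ P) ≡ rename (ext ρ) (rename suc P)
rename-suc-commute ρ = rename-commute λ _ → refl

rename-inst-commute : ∀ ρ y P →
  rename (inst (ρ y)) (rename (ext ρ) P) ≡ rename ρ (rename (inst y) P)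
rename-inst-commute ρ y = rename-commute λ { zero → refl ; (suc n) → refl }

rename-swap-commute : ∀ ρ P →
  rename swap (rename (ext (ext ρ)) P) ≡ rename (ext (ext ρ)) (rename swap P)
rename-swap-commute ρ = rename-commute λ { zero → refl ; (suc zero) → refl ; (suc (suc n)) → refl }

data Subject : Act → ℕ → Set where
  out  : ∀ {x y} → Subject (out x y) x
  bout : ∀ {x} → Subject (bout x) x
  inp  : ∀ {x} → Subject (inp x) x

infix 4 _↓_
_↓_ : Proc → ℕ → Set
P ↓ x = Σ Act λ α → Σ Proc λ P′ → (P ─[ α ]→ P′) × Subject α x

Subject⇒Visible : ∀ {α x} → Subject α x → Visible α
Subject⇒Visible out  ()
Subject⇒Visible bout ()
Subject⇒Visible inp  ()

↓-lift : ∀ {P Q x} → (∀ {α P′} → P ─[ α ]→ P′ → Σ Proc (Q ─[ α ]→_)) → P ↓ x → Q ↓ x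
↓-lift f (α , _ , d , s) with f d
... | Q′ , d′ = α , Q′ , d′ , s

ν-↓ : ∀ {P x} → P ↓ suc x → ν P ↓ x
ν-↓ (out _ zero    , _ , d , out)  = bout _    , _ , open' d , bout
ν-↓ (out _ (suc y) , _ , d , out)  = out _ y   , _ , res d   , out
ν-↓ (bout _        , _ , d , bout) = bout _    , _ , res d   , bout
ν-↓ (inp _         , _ , d , inp)  = inp _     , _ , res d   , inp

↓⇒⇓ : ∀ {P x} → P ↓ x → P ⇓
↓⇒⇓ (α , P′ , d , s) = α , Subject⇒Visible s , P′ , _ , P′ , ε , d , ε

τ-⇓ : ∀ {P P′} → P ─[ τ ]→ P′ → P′ ⇓ → P ⇓
τ-⇓ d (α , v , P″ , P₁ , P₂ , steps , d′ , steps′) = α , v , P″ , P₁ , P₂ , d ◅ steps , d′ , steps′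

rename-reflects-out : ∀ ρ P {z w R} → rename ρ P ─[ out z w ]→ R →
  Σ ℕ λ x → Σ ℕ λ y → Σ Proc λ P′ →
    (P ─[ out x y ]→ P′) × ρ x ≡ z × ρ y ≡ w × R ≡ rename ρ P′
rename-reflects-out ρ (outₚ x y · P) preOut = x , y , P , preOut , refl , refl , refl
rename-reflects-out ρ (P ⊕ Q) (sumL d) with rename-reflects-out ρ P d
... | x , y , P′ , d′ , eˣ , eʸ , eᴿ = x , y , P′ , sumL d′ , eˣ , eʸ , eᴿ
rename-reflects-out ρ (P ⊕ Q) (sumR d) with rename-reflects-out ρ Q d
... | x , y , Q′ , d′ , eˣ , eʸ , eᴿ = x , y , Q′ , sumR d′ , eˣ , eʸ , eᴿ
rename-reflects-out ρ (P ∥ Q) (parL d) with rename-reflects-out ρ P d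
... | x , y , P′ , d′ , eˣ , eʸ , eᴿ =
  x , y , P′ ∥ Q , parL d′ , eˣ , eʸ , cong (_∥ rename ρ Q) eᴿ
rename-reflects-out ρ (P ∥ Q) (parR d) with rename-reflects-out ρ Q d
... | x , y , Q′ , d′ , eˣ , eʸ , eᴿ =
  x , y , P ∥ Q′ , parR d′ , eˣ , eʸ , cong (rename ρ P ∥_) eᴿ
rename-reflects-out ρ (ν P) (res d) with rename-reflects-out (ext ρ) P d
... | zero  , _     , _  , _  , () , _  , _
... | suc x , zero  , _  , _  , _  , () , _
... | suc x , suc y , P′ , d′ , eˣ , eʸ , eᴿ =
  x , y , ν P′ , res d′ , suc-injective eˣ , suc-injective eʸ , cong ν eᴿ
rename-reflects-out ρ (! P) (rep d) with rename-reflects-out ρ (P ∥ ! P) d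
... | x , y , P′ , d′ , eˣ , eʸ , eᴿ = x , y , P′ , rep d′ , eˣ , eʸ , eᴿ

rename-reflects-inp : ∀ ρ P {z R} → rename ρ P ─[ inp z ]→ R →
  Σ ℕ λ x → Σ Proc λ P′ → (P ─[ inp x ]→ P′) × ρ x ≡ z × R ≡ rename (ext ρ) P′
rename-reflects-inp ρ (inpₚ x · P) preInp = x , P , preInp , refl , refl
rename-reflects-inp ρ (P ⊕ Q) (sumL d) with rename-reflects-inp ρ P d
... | x , P′ , d′ , eˣ , eᴿ = x , P′ , sumL d′ , eˣ , eᴿ
rename-reflects-inp ρ (P ⊕ Q) (sumR d) with rename-reflects-inp ρ Q d
... | x , Q′ , d′ , eˣ , eᴿ = x , Q′ , sumR d′ , eˣ , eᴿ
rename-reflects-inp ρ (P ∥ Q) (parL d) with rename-reflects-inp ρ P d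
... | x , P′ , d′ , eˣ , eᴿ =
  x , P′ ∥ rename suc Q , parL d′ , eˣ , cong₂ _∥_ eᴿ (rename-suc-commute ρ Q)
rename-reflects-inp ρ (P ∥ Q) (parR d) with rename-reflects-inp ρ Q d
... | x , Q′ , d′ , eˣ , eᴿ =
  x , rename suc P ∥ Q′ , parR d′ , eˣ , cong₂ _∥_ (rename-suc-commute ρ P) eᴿ
rename-reflects-inp ρ (ν P) (res d) with rename-reflects-inp (ext ρ) P d
... | zero  , _  , _  , () , _
... | suc x , P′ , d′ , eˣ , eᴿ =
  x , ν (rename swap P′) , res d′ , suc-injective eˣ ,
  cong ν (trans (cong (rename swap) eᴿ) (rename-swap-commute ρ P′))
rename-reflects-inp ρ (! P) (rep d) with rename-reflects-inp ρ (P ∥ ! P) d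
... | x , P′ , d′ , eˣ , eᴿ = x , P′ , rep d′ , eˣ , eᴿ

rename-reflects-bout : ∀ ρ P {z R} → rename ρ P ─[ bout z ]→ R →
  Σ ℕ λ x → Σ Proc λ P′ → (P ─[ bout x ]→ P′) × ρ x ≡ z × R ≡ rename (ext ρ) P′
rename-reflects-bout ρ (P ⊕ Q) (sumL d) with rename-reflects-bout ρ P d
... | x , P′ , d′ , eˣ , eᴿ = x , P′ , sumL d′ , eˣ , eᴿ
rename-reflects-bout ρ (P ⊕ Q) (sumR d) with rename-reflects-bout ρ Q d
... | x , Q′ , d′ , eˣ , eᴿ = x , Q′ , sumR d′ , eˣ , eᴿ
rename-reflects-bout ρ (P ∥ Q) (parL d) with rename-reflects-bout ρ P d
... | x , P′ , d′ , eˣ , eᴿ =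
  x , P′ ∥ rename suc Q , parL d′ , eˣ , cong₂ _∥_ eᴿ (rename-suc-commute ρ Q)
rename-reflects-bout ρ (P ∥ Q) (parR d) with rename-reflects-bout ρ Q d
... | x , Q′ , d′ , eˣ , eᴿ =
  x , rename suc P ∥ Q′ , parR d′ , eˣ , cong₂ _∥_ (rename-suc-commute ρ P) eᴿ
rename-reflects-bout ρ (ν P) (res d) with rename-reflects-bout (ext ρ) P d
... | zero  , _  , _  , () , _
... | suc x , P′ , d′ , eˣ , eᴿ =
  x , ν (rename swap P′) , res d′ , suc-injective eˣ ,
  cong ν (trans (cong (rename swap) eᴿ) (rename-swap-commute ρ P′))
rename-reflects-bout ρ (ν P) (open' d) with rename-reflects-out (ext ρ) P d
... | zero  , _     , _  , _  , () , _  , _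
... | suc x , suc _ , _  , _  , _  , () , _
... | suc x , zero  , P′ , d′ , eˣ , _  , eᴿ = x , P′ , open' d′ , suc-injective eˣ , eᴿ
rename-reflects-bout ρ (! P) (rep d) with rename-reflects-bout ρ (P ∥ ! P) d
... | x , P′ , d′ , eˣ , eᴿ = x , P′ , rep d′ , eˣ , eᴿ

rename-reflects-visible : ∀ ρ P {α R} → rename ρ P ─[ α ]→ R → Visible α → P ⇓
rename-reflects-visible ρ P {τ} d v = ⊥-elim (v refl)
rename-reflects-visible ρ P {out _ _} d v with rename-reflects-out ρ P d
... | _ , _ , _ , d′ , _ = ↓⇒⇓ (_ , _ , d′ , out)
rename-reflects-visible ρ P {bout _} d v with rename-reflects-bout ρ P d
... | _ , _ , d′ , _ = ↓⇒⇓ (_ , _ , d′ , bout)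
rename-reflects-visible ρ P {inp _} d v with rename-reflects-inp ρ P d
... | _ , _ , d′ , _ = ↓⇒⇓ (_ , _ , d′ , inp)

-- The source of a τ-move of  rename ρ P  that is not a τ-move of P:
-- a communication between distinct names identified by ρ.
ClashingBarb : (ℕ → ℕ) → Proc → Set
ClashingBarb ρ P = Σ ℕ λ x → Σ ℕ λ x′ → P ↓ x × x ≢ x′ × ρ x ≡ ρ x′

ClashingBarb-lift : ∀ {ρ P Q} → (∀ {α P′} → P ─[ α ]→ P′ → Σ Proc (Q ─[ α ]→_)) →
                    ClashingBarb ρ P → ClashingBarb ρ Q
ClashingBarb-lift f (x , x′ , b , x≢x′ , e) = x , x′ , ↓-lift f b , x≢x′ , e

ClashingBarb-ν : ∀ {ρ P} → ClashingBarb (ext ρ) P → ClashingBarb ρ (ν P)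
ClashingBarb-ν (zero  , zero   , _ , x≢x′ , _) = ⊥-elim (x≢x′ refl)
ClashingBarb-ν (suc x , suc x′ , b , x≢x′ , e) =
  x , x′ , ν-↓ b , (λ x≡x′ → x≢x′ (cong suc x≡x′)) , suc-injective e

ClashingBarb-com : ∀ {ρ P Q x x′ α P′} → P ─[ α ]→ P′ → Subject α x → x ≢ x′ →
                   ρ x′ ≡ ρ x → ClashingBarb ρ (P ∥ Q)
ClashingBarb-com d s x≢x′ e = _ , _ , (_ , _ , parL d , s) , x≢x′ , sym e

rename-reflects-τ : ∀ ρ P {R} → rename ρ P ─[ τ ]→ R →
  ClashingBarb ρ P ⊎ (Σ Proc λ P′ → (P ─[ τ ]→ P′) × R ≡ rename ρ P′)
rename-reflects-τ ρ (tauₚ · P) preτ = inj₂ (P , preτ , refl)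
rename-reflects-τ ρ (P ⊕ Q) (sumL d) with rename-reflects-τ ρ P d
... | inj₁ c              = inj₁ (ClashingBarb-lift (λ d → _ , sumL d) c)
... | inj₂ (P′ , d′ , e) = inj₂ (P′ , sumL d′ , e)
rename-reflects-τ ρ (P ⊕ Q) (sumR d) with rename-reflects-τ ρ Q d
... | inj₁ c              = inj₁ (ClashingBarb-lift (λ d → _ , sumR d) c)
... | inj₂ (Q′ , d′ , e) = inj₂ (Q′ , sumR d′ , e)
rename-reflects-τ ρ (P ∥ Q) (parL d) with rename-reflects-τ ρ P d
... | inj₁ c              = inj₁ (ClashingBarb-lift (λ d → _ , parL d) c)
... | inj₂ (P′ , d′ , e) = inj₂ (P′ ∥ Q , parL d′ , cong (_∥ rename ρ Q) e)
rename-reflects-τ ρ (P ∥ Q) (parR d) with rename-reflects-τ ρ Q d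
... | inj₁ c              = inj₁ (ClashingBarb-lift (λ d → _ , parR d) c)
... | inj₂ (Q′ , d′ , e) = inj₂ (P ∥ Q′ , parR d′ , cong (rename ρ P ∥_) e)
rename-reflects-τ ρ (P ∥ Q) (comL d₁ d₂)
  with rename-reflects-out ρ P d₁ | rename-reflects-inp ρ Q d₂
... | x , y , P′ , d₁′ , refl , refl , refl | x′ , Q′ , d₂′ , e , refl with x ≟ x′
...   | yes refl = inj₂ (P′ ∥ rename (inst y) Q′ , comL d₁′ d₂′ ,
                         cong (rename ρ P′ ∥_) (rename-inst-commute ρ y Q′))
...   | no x≢x′  = inj₁ (ClashingBarb-com d₁′ out x≢x′ e)
rename-reflects-τ ρ (P ∥ Q) (comR d₁ d₂)
  with rename-reflects-inp ρ P d₁ | rename-reflects-out ρ Q d₂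
... | x , P′ , d₁′ , refl , refl | x′ , y , Q′ , d₂′ , e , refl , refl with x ≟ x′
...   | yes refl = inj₂ (rename (inst y) P′ ∥ Q′ , comR d₁′ d₂′ ,
                         cong (_∥ rename ρ Q′) (rename-inst-commute ρ y P′))
...   | no x≢x′  = inj₁ (ClashingBarb-com d₁′ inp x≢x′ e)
rename-reflects-τ ρ (P ∥ Q) (closeL d₁ d₂)
  with rename-reflects-bout ρ P d₁ | rename-reflects-inp ρ Q d₂
... | x , P′ , d₁′ , refl , refl | x′ , Q′ , d₂′ , e , refl with x ≟ x′
...   | yes refl = inj₂ (ν (P′ ∥ Q′) , closeL d₁′ d₂′ , refl)
...   | no x≢x′  = inj₁ (ClashingBarb-com d₁′ bout x≢x′ e)
rename-reflects-τ ρ (P ∥ Q) (closeR d₁ d₂)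
  with rename-reflects-inp ρ P d₁ | rename-reflects-bout ρ Q d₂
... | x , P′ , d₁′ , refl , refl | x′ , Q′ , d₂′ , e , refl with x ≟ x′
...   | yes refl = inj₂ (ν (P′ ∥ Q′) , closeR d₁′ d₂′ , refl)
...   | no x≢x′  = inj₁ (ClashingBarb-com d₁′ inp x≢x′ e)
rename-reflects-τ ρ (ν P) (res d) with rename-reflects-τ (ext ρ) P d
... | inj₁ c              = inj₁ (ClashingBarb-ν c)
... | inj₂ (P′ , d′ , e) = inj₂ (ν P′ , res d′ , cong ν e)
rename-reflects-τ ρ (! P) (rep d) with rename-reflects-τ ρ (P ∥ ! P) d
... | inj₁ c              = inj₁ (ClashingBarb-lift (λ d → _ , rep d) c)
... | inj₂ (P′ , d′ , e) = inj₂ (P′ , rep d′ , e)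

rename-reflects-⇓ : ∀ ρ P {R₁ α R₂} → rename ρ P ⟹ R₁ → R₁ ─[ α ]→ R₂ → Visible α → P ⇓
rename-reflects-⇓ ρ P ε d v = rename-reflects-visible ρ P d v
rename-reflects-⇓ ρ P (s ◅ steps) d v with rename-reflects-τ ρ P s
... | inj₁ (_ , _ , b , _)    = ↓⇒⇓ b
... | inj₂ (P′ , s′ , refl) = τ-⇓ s′ (rename-reflects-⇓ ρ P′ steps d v)

Invisible-rename : ∀ ρ {I} → Invisible I → Invisible (rename ρ I)
Invisible-rename ρ {I} inv (_ , v , _ , _ , _ , steps , d , _) = inv (rename-reflects-⇓ ρ I steps d v)

infix 4 _≼_
data _≼_ : Proc → Proc → Set where
  invisible : ∀ {I P} → Invisible I → I ≼ P
  nil       : 𝟎 ≼ 𝟎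
  prefix    : ∀ π {Q P} → Q ≼ P → π · Q ≼ π · P
  sum       : ∀ {Q₁ Q₂ P₁ P₂} → Q₁ ≼ P₁ → Q₂ ≼ P₂ → Q₁ ⊕ Q₂ ≼ P₁ ⊕ P₂
  par       : ∀ {Q₁ Q₂ P₁ P₂} → Q₁ ≼ P₁ → Q₂ ≼ P₂ → Q₁ ∥ Q₂ ≼ P₁ ∥ P₂
  restrict  : ∀ {Q P} → Q ≼ P → ν Q ≼ ν P
  replicate : ∀ {Q P} → Q ≼ P → ! Q ≼ ! P
  pruneˡ    : ∀ {Q P₁ P₂} → Q ≼ P₁ → Q ≼ P₁ ⊕ P₂
  pruneʳ    : ∀ {Q P₁ P₂} → Q ≼ P₂ → Q ≼ P₁ ⊕ P₂
  unfold    : ∀ {Q P} → Q ≼ P ∥ ! P → Q ≼ ! P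

≼-refl : ∀ P → P ≼ P
≼-refl 𝟎       = nil
≼-refl (π · P) = prefix π (≼-refl P)
≼-refl (P ⊕ Q) = sum (≼-refl P) (≼-refl Q)
≼-refl (P ∥ Q) = par (≼-refl P) (≼-refl Q)
≼-refl (ν P)   = restrict (≼-refl P)
≼-refl (! P)   = replicate (≼-refl P)

≼-fill : ∀ C {I P} → Invisible I → C [ I ] ≼ C [ P ]
≼-fill ∙        inv = invisible inv
≼-fill (π ·ᶜ C) inv = prefix π (≼-fill C inv)
≼-fill (C ⊕ˡ Q) inv = sum (≼-fill C inv) (≼-refl Q)
≼-fill (Q ⊕ʳ C) inv = sum (≼-refl Q) (≼-fill C inv)
≼-fill (C ∥ˡ Q) inv = par (≼-fill C inv) (≼-refl Q)
≼-fill (Q ∥ʳ C) inv = par (≼-refl Q) (≼-fill C inv)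
≼-fill (νᶜ C)   inv = restrict (≼-fill C inv)
≼-fill (!ᶜ C)   inv = replicate (≼-fill C inv)

≼-rename : ∀ ρ {Q P} → Q ≼ P → rename ρ Q ≼ rename ρ P
≼-rename ρ (invisible inv) = invisible (Invisible-rename ρ inv)
≼-rename ρ nil             = nil
≼-rename ρ (prefix π r)    = prefix (renamePre ρ π) (≼-rename (bodyRen π ρ) r)
≼-rename ρ (sum r s)       = sum (≼-rename ρ r) (≼-rename ρ s)
≼-rename ρ (par r s)       = par (≼-rename ρ r) (≼-rename ρ s)
≼-rename ρ (restrict r)    = restrict (≼-rename (ext ρ) r)
≼-rename ρ (replicate r)   = replicate (≼-rename ρ r)
≼-rename ρ (pruneˡ r)      = pruneˡ (≼-rename ρ r)
≼-rename ρ (pruneʳ r)      = pruneʳ (≼-rename ρ r)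
≼-rename ρ (unfold r)      = unfold (≼-rename ρ r)

≼-side : ∀ μ {Q P} → Q ≼ P → side μ Q ≼ side μ P
≼-side τ         r = r
≼-side (out _ _) r = r
≼-side (bout _)  r = ≼-rename suc r
≼-side (inp _)   r = ≼-rename suc r

≼-resCont : ∀ μ {Q P} → Q ≼ P → resCont μ Q ≼ resCont μ P
≼-resCont τ         r = r
≼-resCont (out _ _) r = r
≼-resCont (bout _)  r = ≼-rename swap r
≼-resCont (inp _)   r = ≼-rename swap r

Invisible-step : ∀ {I μ I′} → Invisible I → I ─[ μ ]→ I′ → μ ≡ τ × Invisible I′
Invisible-step {μ = τ}       inv d = refl , λ I′⇓ → inv (τ-⇓ d I′⇓)
Invisible-step {μ = out _ _} inv d = ⊥-elim (inv (↓⇒⇓ (_ , _ , d , out)))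
Invisible-step {μ = bout _}  inv d = ⊥-elim (inv (↓⇒⇓ (_ , _ , d , bout)))
Invisible-step {μ = inp _}   inv d = ⊥-elim (inv (↓⇒⇓ (_ , _ , d , inp)))

Matching : Proc → Act → Proc → Set
Matching P μ Q′ = Σ Proc λ P′ → (P ─[ μ ]→ P′) × Q′ ≼ P′

Answer : Proc → Act → Proc → Set
Answer P μ Q′ = Matching P μ Q′ ⊎ (μ ≡ τ × Q′ ≼ P)

Answer-lift : ∀ {P₁ P₂ μ Q′} → (∀ {P′} → P₁ ─[ μ ]→ P′ → P₂ ─[ μ ]→ P′) →
              (Q′ ≼ P₁ → Q′ ≼ P₂) → Answer P₁ μ Q′ → Answer P₂ μ Q′
Answer-lift f g (inj₁ (P′ , d , r)) = inj₁ (P′ , f d , r)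
Answer-lift f g (inj₂ (e , r))      = inj₂ (e , g r)

shiftAct-τ : ∀ {μ} → shiftAct μ ≡ τ → μ ≡ τ
shiftAct-τ {τ} _ = refl

mutual
  ≼-step : ∀ {Q P μ Q′} → Q ≼ P → Q ─[ μ ]→ Q′ → Answer P μ Q′
  ≼-step (invisible inv) d with Invisible-step inv d
  ... | e , inv′ = inj₂ (e , invisible inv′)
  ≼-step (prefix _ r) preτ   = inj₁ (_ , preτ , r)
  ≼-step (prefix _ r) preOut = inj₁ (_ , preOut , r)
  ≼-step (prefix _ r) preInp = inj₁ (_ , preInp , r)
  ≼-step (sum r _) (sumL d)  = Answer-lift sumL pruneˡ (≼-step r d)
  ≼-step (sum _ s) (sumR d)  = Answer-lift sumR pruneʳ (≼-step s d)
  ≼-step (par r s) (parL {α = μ} d) with ≼-step r d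
  ... | inj₁ (_ , d′ , r′) = inj₁ (_ , parL d′ , par r′ (≼-side μ s))
  ... | inj₂ (refl , r′)   = inj₂ (refl , par r′ s)
  ≼-step (par r s) (parR {α = μ} d) with ≼-step s d
  ... | inj₁ (_ , d′ , s′) = inj₁ (_ , parR d′ , par (≼-side μ r) s′)
  ... | inj₂ (refl , s′)   = inj₂ (refl , par r s′)
  ≼-step (par r s) (comL {y = y} d₁ d₂) with ≼-visible-step r d₁ (λ ()) | ≼-visible-step s d₂ (λ ())
  ... | _ , d₁′ , r′ | _ , d₂′ , s′ = inj₁ (_ , comL d₁′ d₂′ , par r′ (≼-rename (inst y) s′))
  ≼-step (par r s) (comR {y = y} d₁ d₂) with ≼-visible-step r d₁ (λ ()) | ≼-visible-step s d₂ (λ ())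
  ... | _ , d₁′ , r′ | _ , d₂′ , s′ = inj₁ (_ , comR d₁′ d₂′ , par (≼-rename (inst y) r′) s′)
  ≼-step (par r s) (closeL d₁ d₂) with ≼-visible-step r d₁ (λ ()) | ≼-visible-step s d₂ (λ ())
  ... | _ , d₁′ , r′ | _ , d₂′ , s′ = inj₁ (_ , closeL d₁′ d₂′ , restrict (par r′ s′))
  ≼-step (par r s) (closeR d₁ d₂) with ≼-visible-step r d₁ (λ ()) | ≼-visible-step s d₂ (λ ())
  ... | _ , d₁′ , r′ | _ , d₂′ , s′ = inj₁ (_ , closeR d₁′ d₂′ , restrict (par r′ s′))
  ≼-step (restrict r) (res {α = μ} d) with ≼-step r d
  ... | inj₁ (_ , d′ , r′) = inj₁ (_ , res d′ , restrict (≼-resCont μ r′))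
  ... | inj₂ (e , r′) with shiftAct-τ {μ} e
  ...   | refl = inj₂ (refl , restrict r′)
  ≼-step (restrict r) (open' d) with ≼-visible-step r d (λ ())
  ... | P′ , d′ , r′ = inj₁ (P′ , open' d′ , r′)
  ≼-step (replicate r) (rep d) = Answer-lift rep unfold (≼-step (par r (replicate r)) d)
  ≼-step (pruneˡ r) d = Answer-lift sumL pruneˡ (≼-step r d)
  ≼-step (pruneʳ r) d = Answer-lift sumR pruneʳ (≼-step r d)
  ≼-step (unfold r) d = Answer-lift rep unfold (≼-step r d)

  ≼-visible-step : ∀ {Q P μ Q′} → Q ≼ P → Q ─[ μ ]→ Q′ → Visible μ → Matching P μ Q′
  ≼-visible-step r d v with ≼-step r d
  ... | inj₁ m        = m
  ... | inj₂ (e , _) = ⊥-elim (v e)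

step⇒weakHat : ∀ μ {P P′} → P ─[ μ ]→ P′ → weakHat P μ P′
step⇒weakHat τ         d = d ◅ ε
step⇒weakHat (out _ _) d = _ , _ , ε , d , ε
step⇒weakHat (bout _)  d = _ , _ , ε , d , ε
step⇒weakHat (inp _)   d = _ , _ , ε , d , ε

≼⇒≲ : ∀ k {Q P} → Q ≼ P → Q ≲[ k ] P
≼⇒≲ zero    r = tt
≼⇒≲ (suc k) r μ Q′ d with ≼-step r d
... | inj₁ (P′ , d′ , r′) = P′ , step⇒weakHat μ d′ , ≼⇒≲ k r′
... | inj₂ (refl , r′)    = _ , ε , ≼⇒≲ k r′

lemma3p5 : (C : Ctx) (I P : Proc) → Invisible I → (C [ I ]) ≲ω (C [ P ])
lemma3p5 C I P inv k = ≼⇒≲ k (≼-fill C inv)
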